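{- Let $f_{4,c}(x)=x^4+c$. There are infinitely many $c\in\mathbb{Q}$ such that $f_{4,c}$ has rational periodic points of exact period $2$. Such $c$ and the corresponding $2$-periodic points $x_1,x_2$ are parametrized as follows: $c=\dfrac{t^6+4t^3-1}{4t^2}$ and $x_1,x_2=\dfrac{t^2\pm\sqrt{ -t^4-2t}}{2t}$, where $t$ is a nonzero rational number such that $-t^4-2t=y^2$ for some $y\in\mathbb{Q}$.
   Context: A point $x$ is a periodic point of exact period $2$ of $f$ if $f(f(x))=x$ and $f(x)\neq x$. -}

module Defs where

open import Data.Rational using (ℚ; _+_; _*_; _-_; -_; 1/_; 0ℚ; 1ℚ; ≢-nonZero)
open import Data.Product using (_×_)
open import Relation.Binary.PropositionalEquality using (_≡_; _≢_)

2ℚ 4ℚ : ℚ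
2ℚ = 1ℚ + 1ℚ
4ℚ = 2ℚ + 2ℚ

f4 : ℚ → ℚ → ℚ
f4 c x = x * x * x * x + c

IsPeriod2 : (ℚ → ℚ) → ℚ → Set
IsPeriod2 f x = (f (f x) ≡ x) × (f x ≢ x)

_÷[_]_ : ℚ → (t : ℚ) → t ≢ 0ℚ → ℚ
(p ÷[ t ] t≢0) = p * (1/ t) {{≢-nonZero t≢0}}

cPar : (t : ℚ) → t ≢ 0ℚ → ℚ
cPar t t≢0 =
  ((((t * t * t * t * t * t + 4ℚ * (t * t * t) - 1ℚ) ÷[ t ] t≢0) ÷[ t ] t≢0) * (1/ 4ℚ))

-- x = (t^2 + s) / (2t), where s = ± sqrt(-t^4 - 2t)
xPar : (t : ℚ) → t ≢ 0ℚ → ℚ → ℚ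
xPar t t≢0 s = ((t * t + s) ÷[ t ] t≢0) * (1/ 2ℚ)

{-# OPTIONS --safe #-}
-- Subtracting the two equations of a 2-cycle x₁ ↦ x₂ ↦ x₁ of x⁴ + c gives (x₁ - x₂) Φ = 0 with
-- Φ = (x₁ + x₂)(x₁² + x₂²) + 1. In the coordinates t = x₁ + x₂, y = t (x₁ - x₂) the equation Φ = 0
-- is y² = -t⁴ - 2t, and c, x₁, x₂ are rational functions of (t, y); the degenerate case y = 0 would
-- need a rational cube root of -2.
-- The quartic y² = -t⁴ - 2t is birational to the Mordell curve Y² = X³ - 4 via t = -2/X, y = 2Y/X².
-- Doubling (5, 11) n times gives X = A/D², Y = B/D³ with A, B odd and 2ⁿ ∣ D; the corresponding c
-- has odd numerator over 16 A⁴ D⁴, so its denominator is divisible by 2ⁿ, and no finite list of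
-- rationals contains all of these values of c.
module Submission where

open import Defs
open import Data.Rational using (ℚ; _+_; _*_; _-_; -_; 0ℚ)
open import Data.Product using (_×_; _,_; ∃-syntax; Σ-syntax)
open import Data.List using (List)
open import Data.List.Membership.Propositional using (_∉_)
open import Function.Bundles using (_⇔_)
open import Relation.Binary.PropositionalEquality using (_≡_; _≢_)

open import Agda.Builtin.FromNat using (Number; fromNat)
open import Algebra.Properties.Group using (x∙y⁻¹≈ε⇒x≈y; x≈y⇒x∙y⁻¹≈ε; inverseˡ-unique)
open import Data.Empty using (⊥-elim)
open import Data.Integer using (ℤ)
import Data.Integer as ℤ
import Data.Integer.Divisibility.Signed as ℤ∣
import Data.Integer.Literals as ℤ-Literals
import Data.Integer.Properties as ℤ
open import Data.Integer.Tactic.RingSolver using () renaming (solve-∀ to ℤ-solve-∀; ring to ℤ-ring)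
open import Data.List using (map; _∷_; [])
open import Data.List.Extrema.Nat using (max; xs≤max)
open import Data.List.Membership.Propositional using (_∈_)
open import Data.List.Membership.Propositional.Properties using (∈-map⁺)
import Data.List.Relation.Unary.All as All
open import Data.Nat using (ℕ; zero; suc)
import Data.Nat as ℕ
open import Data.Nat.Coprimality using (Coprime)
import Data.Nat.Coprimality as Coprime
open import Data.Nat.Divisibility
  using (_∣_; divides; ∣-trans; _∣0; 1∣_; m∣m*n; ∣n⇒∣m*n; *-monoʳ-∣; *-cancelˡ-∣; ∣⇒≤)
import Data.Nat.Literals as ℕ-Literals
open import Data.Nat.Primality using (Prime; euclidsLemma; prime[2]; ¬prime[1]; prime⇒nonZero)
import Data.Nat.Properties as ℕ
open import Data.Nat.Tactic.RingSolver using () renaming (solve-∀ to ℕ-solve-∀)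
open import Data.Product using (proj₁; map₁; map₂)
open import Data.Rational using (1ℚ; 1/_; ≢-nonZero; mkℚ; ↥_; ↧_; ↧ₙ_; toℚᵘ)
open import Data.Rational.Literals using (fromℤ)
import Data.Rational.Literals as ℚ-Literals
open import Data.Rational.Properties
  using (+-*-commutativeRing; _≟_; +-0-group; 1≢0; +-comm; *-assoc; *-identityˡ; *-identityʳ;
         *-zeroˡ; *-zeroʳ; +-identityʳ; *-inverseˡ; *-inverseʳ; neg-injective; p≡0⇒↥p≡0;
         toℚᵘ-homo-+; toℚᵘ-homo-*; toℚᵘ-homo‿-; toℚᵘ-injective; toℚᵘ-cong)
import Data.Rational.Unnormalised.Base as ℚᵘ
import Data.Rational.Unnormalised.Properties as ℚᵘ
open import Data.Sum using ([_,_]′; inj₁; inj₂)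
open import Data.Unit using (⊤; tt)
open import Function using (_∘_; id)
open import Function.Bundles using (mk⇔; Equivalence)
open import Function.Construct.Composition using (_⇔-∘_)
open import Function.Construct.Symmetry using (⇔-sym)
open import Level using (0ℓ)
open import Relation.Binary.PropositionalEquality
  using (refl; sym; trans; cong; cong₂; subst; module ≡-Reasoning)
open import Relation.Nullary using (¬_)
open import Relation.Nullary.Decidable using (dec⇒maybe; from-no)
open import Tactic.RingSolver using (solve-∀; solve)
open import Tactic.RingSolver.Core.AlmostCommutativeRing using (AlmostCommutativeRing; fromCommutativeRing)

open Equivalence using (to; from)
open ≡-Reasoning

instance
  ℚ-number : Number ℚ
  ℚ-number = ℚ-Literals.number
  ℤ-number : Number ℤ
  ℤ-number = ℤ-Literals.number
  ℕ-number : Number ℕ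
  ℕ-number = ℕ-Literals.number
  literal-constraint : ⊤
  literal-constraint = tt

ℚ-ring : AlmostCommutativeRing 0ℓ 0ℓ
ℚ-ring = fromCommutativeRing +-*-commutativeRing (λ x → dec⇒maybe (0ℚ ≟ x))

2≢0 : 2ℚ ≢ 0ℚ
2≢0 ()

4≢0 : 4ℚ ≢ 0ℚ
4≢0 ()

*-cancelˡ-≡ : ∀ {r p q} → r ≢ 0ℚ → r * p ≡ r * q → p ≡ q
*-cancelˡ-≡ {r} {p} {q} r≢0 eq = begin
  p                ≡⟨ r⁻¹*[r*x]≡x p ⟨
  1/ r * (r * p)   ≡⟨ cong (1/ r *_) eq ⟩
  1/ r * (r * q)   ≡⟨ r⁻¹*[r*x]≡x q ⟩
  q                ∎
  where
  instance _ = ≢-nonZero r≢0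
  r⁻¹*[r*x]≡x : ∀ x → 1/ r * (r * x) ≡ x
  r⁻¹*[r*x]≡x x = trans (sym (*-assoc (1/ r) r x)) (trans (cong (_* x) (*-inverseˡ r)) (*-identityˡ x))

*≡0⇒≡0 : ∀ {r q} → r ≢ 0ℚ → r * q ≡ 0ℚ → q ≡ 0ℚ
*≡0⇒≡0 {r} r≢0 eq = *-cancelˡ-≡ r≢0 (trans eq (sym (*-zeroʳ r)))

-≡0⇒≡ : ∀ {p q} → p - q ≡ 0ℚ → p ≡ q
-≡0⇒≡ = x∙y⁻¹≈ε⇒x≈y +-0-group _ _

≡⇒-≡0 : ∀ {p q} → p ≡ q → p - q ≡ 0ℚ
≡⇒-≡0 = x≈y⇒x∙y⁻¹≈ε +-0-group

q≡0⇒p+r*q≡p : ∀ {q} p r → q ≡ 0ℚ → p + r * q ≡ p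
q≡0⇒p+r*q≡p p r refl = trans (cong (p +_) (*-zeroʳ r)) (+-identityʳ p)

*-inverse⇒⇔ : ∀ {t u p q} → t * u ≡ 1ℚ → (p * u ≡ q) ⇔ (p ≡ t * q)
*-inverse⇒⇔ {t} {u} {p} {q} tu≡1 = mk⇔
  (λ { refl → begin
    p               ≡⟨ *-identityʳ p ⟨
    p * 1ℚ          ≡⟨ cong (p *_) tu≡1 ⟨
    p * (t * u)     ≡⟨ solve (t ∷ u ∷ p ∷ []) ℚ-ring ⟩
    t * (p * u)     ∎ })
  (λ { refl → begin
    t * q * u       ≡⟨ solve (t ∷ u ∷ q ∷ []) ℚ-ring ⟩
    q * (t * u)     ≡⟨ cong (q *_) tu≡1 ⟩
    q * 1ℚ          ≡⟨ *-identityʳ q ⟩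
    q               ∎ })

÷⇔ : ∀ {t p q} (t≢0 : t ≢ 0ℚ) → (p ÷[ t ] t≢0 ≡ q) ⇔ (p ≡ t * q)
÷⇔ {t} t≢0 = *-inverse⇒⇔ {t = t} (*-inverseʳ t)
  where instance _ = ≢-nonZero t≢0

*-÷ : ∀ {t p} (t≢0 : t ≢ 0ℚ) → t * (p ÷[ t ] t≢0) ≡ p
*-÷ t≢0 = sym (to (÷⇔ t≢0) refl)

cPar⇔ : ∀ {t c} (t≢0 : t ≢ 0ℚ) →
        (cPar t t≢0 ≡ c) ⇔ (t * t * t * t * t * t + 4ℚ * (t * t * t) - 1ℚ ≡ t * (t * (4ℚ * c)))
cPar⇔ t≢0 = ÷⇔ t≢0 ⇔-∘ (÷⇔ t≢0 ⇔-∘ *-inverse⇒⇔ refl)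

xPar⇔ : ∀ {t s x} (t≢0 : t ≢ 0ℚ) → (xPar t t≢0 s ≡ x) ⇔ (t * t + s ≡ t * (2ℚ * x))
xPar⇔ t≢0 = ÷⇔ t≢0 ⇔-∘ *-inverse⇒⇔ refl

xPar-+ : ∀ {t} (t≢0 : t ≢ 0ℚ) s → xPar t t≢0 s + xPar t t≢0 (- s) ≡ t
xPar-+ {t} t≢0 s = begin
  ((t * t + s) * u) * (1/ 2ℚ) + ((t * t + - s) * u) * (1/ 2ℚ)   ≡⟨ halves t s u ⟩
  t * (t * u)                                                   ≡⟨ cong (t *_) (*-inverseʳ t) ⟩
  t * 1ℚ                                                        ≡⟨ *-identityʳ t ⟩
  t                                                             ∎
  where
  instance _ = ≢-nonZero t≢0
  u = 1/ t
  halves : ∀ t s u → ((t * t + s) * u) * (1/ 2ℚ) + ((t * t + - s) * u) * (1/ 2ℚ) ≡ t * (t * u)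
  halves = solve-∀ ℚ-ring

xPar-- : ∀ {t} (t≢0 : t ≢ 0ℚ) s → t * (xPar t t≢0 s - xPar t t≢0 (- s)) ≡ s
xPar-- {t} t≢0 s = begin
  t * (((t * t + s) * u) * (1/ 2ℚ) - ((t * t + - s) * u) * (1/ 2ℚ))   ≡⟨ halves t s u ⟩
  s * (t * u)                                                         ≡⟨ cong (s *_) (*-inverseʳ t) ⟩
  s * 1ℚ                                                              ≡⟨ *-identityʳ s ⟩
  s                                                                   ∎
  where
  instance _ = ≢-nonZero t≢0
  u = 1/ t
  halves : ∀ t s u → t * (((t * t + s) * u) * (1/ 2ℚ) - ((t * t + - s) * u) * (1/ 2ℚ)) ≡ s * (t * u)
  halves = solve-∀ ℚ-ring

*fromℤ≡fromℤ⇔ : ∀ q m n → (q * fromℤ m ≡ fromℤ n) ⇔ (↥ q ℤ.* m ≡ n ℤ.* ↧ q)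
*fromℤ≡fromℤ⇔ q@(mkℚ _ d _) m n = mk⇔
  (λ eq → cross (ℚᵘ.≃-trans (ℚᵘ.≃-sym (toℚᵘ-homo-* q (fromℤ m))) (toℚᵘ-cong eq)))
  (λ eq → toℚᵘ-injective (ℚᵘ.≃-trans (toℚᵘ-homo-* q (fromℤ m)) (uncross eq)))
  where
  ↧q≡ : ↧ q ≡ ℤ.+ suc (d ℕ.* 1)
  ↧q≡ = cong (λ k → ℤ.+ suc k) (sym (ℕ.*-identityʳ d))
  cross : toℚᵘ q ℚᵘ.* ℚᵘ.mkℚᵘ m 0 ℚᵘ.≃ ℚᵘ.mkℚᵘ n 0 → ↥ q ℤ.* m ≡ n ℤ.* ↧ q
  cross (ℚᵘ.*≡* e) = trans (sym (ℤ.*-identityʳ _)) (trans e (cong (n ℤ.*_) (sym ↧q≡)))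
  uncross : ↥ q ℤ.* m ≡ n ℤ.* ↧ q → toℚᵘ q ℚᵘ.* ℚᵘ.mkℚᵘ m 0 ℚᵘ.≃ ℚᵘ.mkℚᵘ n 0
  uncross e = ℚᵘ.*≡* (trans (ℤ.*-identityʳ _) (trans e (cong (n ℤ.*_) ↧q≡)))

fromℤ-* : ∀ m n → fromℤ (m ℤ.* n) ≡ fromℤ m * fromℤ n
fromℤ-* m n = toℚᵘ-injective (ℚᵘ.≃-sym (toℚᵘ-homo-* (fromℤ m) (fromℤ n)))

fromℤ-+ : ∀ m n → fromℤ (m ℤ.+ n) ≡ fromℤ m + fromℤ n
fromℤ-+ m n =
  toℚᵘ-injective (ℚᵘ.≃-sym (ℚᵘ.≃-trans (toℚᵘ-homo-+ (fromℤ m) (fromℤ n)) (ℚᵘ.*≡* (identity m n))))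
  where
  identity : ∀ m n → (m ℤ.* 1 ℤ.+ n ℤ.* 1) ℤ.* 1 ≡ (m ℤ.+ n) ℤ.* 1
  identity = ℤ-solve-∀

fromℤ-- : ∀ m n → fromℤ (m ℤ.- n) ≡ fromℤ m - fromℤ n
fromℤ-- m n = trans (fromℤ-+ m (ℤ.- n)) (cong (fromℤ m +_) (fromℤ-neg n))
  where
  fromℤ-neg : ∀ n → fromℤ (ℤ.- n) ≡ - fromℤ n
  fromℤ-neg n = toℚᵘ-injective (ℚᵘ.≃-sym (toℚᵘ-homo‿- (fromℤ n)))

fromℤ-cube : ∀ z → fromℤ (z ℤ.* z ℤ.* z) ≡ fromℤ z * fromℤ z * fromℤ z
fromℤ-cube z = trans (fromℤ-* (z ℤ.* z) z) (cong (_* fromℤ z) (fromℤ-* z z))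

fromℤ-≢0 : ∀ {z} → z ≢ 0 → fromℤ z ≢ 0ℚ
fromℤ-≢0 {z} z≢0 = z≢0 ∘ p≡0⇒↥p≡0 (fromℤ z)

-- No rational cube root of -2

prime∣cube⇒prime∣ : ∀ {p m} → Prime p → p ∣ m ℕ.* m ℕ.* m → p ∣ m
prime∣cube⇒prime∣ {p} {m} p-prime p∣m³ =
  [ [ id , id ]′ ∘ euclidsLemma m m p-prime , id ]′ (euclidsLemma (m ℕ.* m) m p-prime p∣m³)

coprime⇒cube≢prime*cube : ∀ {p a b} → Prime p → Coprime a b → a ℕ.* a ℕ.* a ≢ p ℕ.* (b ℕ.* b ℕ.* b)
coprime⇒cube≢prime*cube {p} {a} {b} p-prime coprime a³≡pb³
  with prime∣cube⇒prime∣ {m = a} p-prime (divides (b ℕ.* b ℕ.* b) (trans a³≡pb³ (ℕ.*-comm p _)))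
... | p∣a@(divides k refl) = ¬prime[1] (subst Prime (coprime (p∣a , p∣b)) p-prime)
  where
  instance _ = prime⇒nonZero p-prime
  b³≡p*[p*k³] : b ℕ.* b ℕ.* b ≡ p ℕ.* (p ℕ.* (k ℕ.* k ℕ.* k))
  b³≡p*[p*k³] = ℕ.*-cancelˡ-≡ _ _ p (trans (sym a³≡pb³) (identity k p))
    where
    identity : ∀ k p → k ℕ.* p ℕ.* (k ℕ.* p) ℕ.* (k ℕ.* p) ≡ p ℕ.* (p ℕ.* (p ℕ.* (k ℕ.* k ℕ.* k)))
    identity = ℕ-solve-∀
  p∣b : p ∣ b
  p∣b = prime∣cube⇒prime∣ p-prime (divides (p ℕ.* (k ℕ.* k ℕ.* k)) (trans b³≡p*[p*k³] (ℕ.*-comm p _)))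

∣cube∣ : ∀ z → ℤ.∣ z ℤ.* z ℤ.* z ∣ ≡ ℤ.∣ z ∣ ℕ.* ℤ.∣ z ∣ ℕ.* ℤ.∣ z ∣
∣cube∣ z = trans (ℤ.abs-* (z ℤ.* z) z) (cong (ℕ._* ℤ.∣ z ∣) (ℤ.abs-* z z))

t³≢-2 : ∀ t → t * t * t ≢ - 2ℚ
t³≢-2 t@(mkℚ n d coprime) t³≡-2 =
  coprime⇒cube≢prime*cube prime[2] (Coprime.recompute coprime) (begin
    ℤ.∣ n ∣ ℕ.* ℤ.∣ n ∣ ℕ.* ℤ.∣ n ∣      ≡⟨ ∣cube∣ n ⟨
    ℤ.∣ n ℤ.* n ℤ.* n ∣                  ≡⟨ cong ℤ.∣_∣ (ℤ.*-identityʳ (n ℤ.* n ℤ.* n)) ⟨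
    ℤ.∣ n ℤ.* n ℤ.* n ℤ.* 1 ∣            ≡⟨ cong ℤ.∣_∣ n³≡-2D³ ⟨
    ℤ.∣ ↥ (- 2ℚ) ℤ.* (D ℤ.* D ℤ.* D) ∣   ≡⟨ ℤ.abs-* (↥ (- 2ℚ)) (D ℤ.* D ℤ.* D) ⟩
    2 ℕ.* ℤ.∣ D ℤ.* D ℤ.* D ∣            ≡⟨ cong (2 ℕ.*_) (∣cube∣ D) ⟩
    2 ℕ.* (suc d ℕ.* suc d ℕ.* suc d)    ∎)
  where
  D = ↧ t
  cube-* : ∀ x y → x * x * x * (y * y * y) ≡ (x * y) * (x * y) * (x * y)
  cube-* = solve-∀ ℚ-ring
  tD≡n : t * fromℤ D ≡ fromℤ n
  tD≡n = from (*fromℤ≡fromℤ⇔ t D n) refl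
  t³D³≡n³ : t * t * t * fromℤ (D ℤ.* D ℤ.* D) ≡ fromℤ (n ℤ.* n ℤ.* n)
  t³D³≡n³ = begin
    t * t * t * fromℤ (D ℤ.* D ℤ.* D)                ≡⟨ cong (t * t * t *_) (fromℤ-cube D) ⟩
    t * t * t * (fromℤ D * fromℤ D * fromℤ D)        ≡⟨ cube-* t (fromℤ D) ⟩
    (t * fromℤ D) * (t * fromℤ D) * (t * fromℤ D)    ≡⟨ cong (λ x → x * x * x) tD≡n ⟩
    fromℤ n * fromℤ n * fromℤ n                      ≡⟨ fromℤ-cube n ⟨
    fromℤ (n ℤ.* n ℤ.* n)                            ∎
  n³≡-2D³ : ↥ (- 2ℚ) ℤ.* (D ℤ.* D ℤ.* D) ≡ n ℤ.* n ℤ.* n ℤ.* 1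
  n³≡-2D³ = to (*fromℤ≡fromℤ⇔ (- 2ℚ) (D ℤ.* D ℤ.* D) (n ℤ.* n ℤ.* n))
              (subst (λ q → q * fromℤ (D ℤ.* D ℤ.* D) ≡ fromℤ (n ℤ.* n ℤ.* n)) t³≡-2 t³D³≡n³)

quartic≢0 : ∀ {t} → t ≢ 0ℚ → - (t * t * t * t) - 2ℚ * t ≢ 0ℚ
quartic≢0 {t} t≢0 quartic≡0 =
  t³≢-2 t (inverseˡ-unique +-0-group _ _ (neg-injective (*≡0⇒≡0 t≢0 (trans (factor t) quartic≡0))))
  where
  factor : ∀ t → t * - (t * t * t + 2ℚ) ≡ - (t * t * t * t) - 2ℚ * t
  factor = solve-∀ ℚ-ring

-- 2-cycles of x⁴ + c

-- x₁⁴ - x₂⁴ + x₁ - x₂ = (x₁ - x₂) Φ x₁ x₂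
Φ : ℚ → ℚ → ℚ
Φ x₁ x₂ = (x₁ + x₂) * (x₁ * x₁ + x₂ * x₂) + 1ℚ

Φ-comm : ∀ x₁ x₂ → Φ x₁ x₂ ≡ Φ x₂ x₁
Φ-comm = identity
  where
  identity : ∀ x₁ x₂ → (x₁ + x₂) * (x₁ * x₁ + x₂ * x₂) + 1ℚ ≡ (x₂ + x₁) * (x₂ * x₂ + x₁ * x₁) + 1ℚ
  identity = solve-∀ ℚ-ring

two-cycle⇒Φ≡0 : ∀ {c x₁ x₂} → f4 c x₁ ≡ x₂ → f4 c x₂ ≡ x₁ → x₁ ≢ x₂ → Φ x₁ x₂ ≡ 0ℚ
two-cycle⇒Φ≡0 {c} {x₁} {x₂} fx₁≡x₂ fx₂≡x₁ x₁≢x₂ = *≡0⇒≡0 (x₁≢x₂ ∘ -≡0⇒≡) (begin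
  (x₁ - x₂) * Φ x₁ x₂               ≡⟨ f4-difference c x₁ x₂ ⟨
  (f4 c x₁ - x₂) - (f4 c x₂ - x₁)   ≡⟨ cong₂ _-_ (≡⇒-≡0 fx₁≡x₂) (≡⇒-≡0 fx₂≡x₁) ⟩
  0ℚ                                ∎)
  where
  f4-difference : ∀ c x₁ x₂ → (x₁ * x₁ * x₁ * x₁ + c - x₂) - (x₂ * x₂ * x₂ * x₂ + c - x₁)
                              ≡ (x₁ - x₂) * ((x₁ + x₂) * (x₁ * x₁ + x₂ * x₂) + 1ℚ)
  f4-difference = solve-∀ ℚ-ring

Φ≡0⇒+≢0 : ∀ {x₁ x₂} → Φ x₁ x₂ ≡ 0ℚ → x₁ + x₂ ≢ 0ℚ
Φ≡0⇒+≢0 {x₁} {x₂} Φ≡0 t≡0 = 1≢0 (begin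
  0ℚ + 1ℚ                          ≡⟨ cong (_+ 1ℚ) (*-zeroˡ (x₁ * x₁ + x₂ * x₂)) ⟨
  0ℚ * (x₁ * x₁ + x₂ * x₂) + 1ℚ   ≡⟨ cong (λ t → t * (x₁ * x₁ + x₂ * x₂) + 1ℚ) t≡0 ⟨
  Φ x₁ x₂                          ≡⟨ Φ≡0 ⟩
  0ℚ                               ∎)

Φ≡0⇔quartic : ∀ {x₁ x₂ t y} → x₁ + x₂ ≡ t → t * (x₁ - x₂) ≡ y → t ≢ 0ℚ →
              (Φ x₁ x₂ ≡ 0ℚ) ⇔ (y * y ≡ - (t * t * t * t) - 2ℚ * t)
Φ≡0⇔quartic {x₁} {x₂} refl refl t≢0 = mk⇔
  (λ Φ≡0 → -≡0⇒≡ (trans (quartic-Φ x₁ x₂) (trans (cong (λ φ → t * (2ℚ * φ)) Φ≡0) (*-zeroʳ t))))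
  (λ quartic → *≡0⇒≡0 2≢0 (*≡0⇒≡0 t≢0 (trans (sym (quartic-Φ x₁ x₂)) (≡⇒-≡0 quartic))))
  where
  t = x₁ + x₂
  quartic-Φ : ∀ x₁ x₂ → let t = x₁ + x₂ in
    t * (x₁ - x₂) * (t * (x₁ - x₂)) - (- (t * t * t * t) - 2ℚ * t)
      ≡ t * (2ℚ * (t * (x₁ * x₁ + x₂ * x₂) + 1ℚ))
  quartic-Φ x₁ x₂ = solve (x₁ ∷ x₂ ∷ []) ℚ-ring

f4≡⇔cPar≡ : ∀ {c x₁ x₂ t} → Φ x₁ x₂ ≡ 0ℚ → x₁ + x₂ ≡ t → (t≢0 : t ≢ 0ℚ) →
            (f4 c x₁ ≡ x₂) ⇔ (cPar t t≢0 ≡ c)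
f4≡⇔cPar≡ {c} {x₁} {x₂} Φ≡0 refl t≢0 = ⇔-sym (cPar⇔ t≢0) ⇔-∘ mk⇔
  (λ fx₁≡x₂ → sym (-≡0⇒≡ (begin
    t * (t * (4ℚ * c)) - P                ≡⟨ key ⟩
    t * (t * (4ℚ * (f4 c x₁ - x₂)))       ≡⟨ cong (λ z → t * (t * (4ℚ * z))) (≡⇒-≡0 fx₁≡x₂) ⟩
    t * (t * 0ℚ)                          ≡⟨ cong (t *_) (*-zeroʳ t) ⟩
    t * 0ℚ                                ≡⟨ *-zeroʳ t ⟩
    0ℚ                                    ∎)))
  (λ P≡ → -≡0⇒≡ (*≡0⇒≡0 4≢0 (*≡0⇒≡0 t≢0 (*≡0⇒≡0 t≢0 (trans (sym key) (≡⇒-≡0 (sym P≡)))))))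
  where
  t = x₁ + x₂
  P = t * t * t * t * t * t + 4ℚ * (t * t * t) - 1ℚ
  k = 5 * (x₁ * x₁ * x₁) + 9 * (x₁ * x₁ * x₂) + 5 * (x₁ * x₂ * x₂) + x₂ * x₂ * x₂ - 1ℚ
  cPar-Φ : ∀ c x₁ x₂ → let t = x₁ + x₂ in
    t * (t * (4ℚ * c)) - (t * t * t * t * t * t + 4ℚ * (t * t * t) - 1ℚ)
      + (5 * (x₁ * x₁ * x₁) + 9 * (x₁ * x₁ * x₂) + 5 * (x₁ * x₂ * x₂) + x₂ * x₂ * x₂ - 1ℚ)
        * (t * (x₁ * x₁ + x₂ * x₂) + 1ℚ)
    ≡ t * (t * (4ℚ * (x₁ * x₁ * x₁ * x₁ + c - x₂)))
  cPar-Φ c x₁ x₂ = solve (c ∷ x₁ ∷ x₂ ∷ []) ℚ-ring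
  key : t * (t * (4ℚ * c)) - P ≡ t * (t * (4ℚ * (f4 c x₁ - x₂)))
  key = trans (sym (q≡0⇒p+r*q≡p _ k Φ≡0)) (cPar-Φ c x₁ x₂)

TwoCycle : ℚ → ℚ → ℚ → Set
TwoCycle c x₁ x₂ = IsPeriod2 (f4 c) x₁ × (f4 c x₁ ≡ x₂)

Parametrised : ℚ → ℚ → ℚ → Set
Parametrised c x₁ x₂ = ∃[ t ] ∃[ y ] Σ[ t≢0 ∈ t ≢ 0ℚ ]
  ((y * y ≡ - (t * t * t * t) - 2ℚ * t)
   × (c ≡ cPar t t≢0) × (x₁ ≡ xPar t t≢0 y) × (x₂ ≡ xPar t t≢0 (- y)))

twoCycle⇒parametrised : ∀ {c x₁ x₂} → TwoCycle c x₁ x₂ → Parametrised c x₁ x₂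
twoCycle⇒parametrised {c} {x₁} {x₂} ((f²x₁≡x₁ , fx₁≢x₁) , fx₁≡x₂) =
  t , t * (x₁ - x₂) , t≢0
    , to (Φ≡0⇔quartic {x₁} {x₂} refl refl t≢0) Φ≡0
    , sym (to (f4≡⇔cPar≡ {c} {x₁} {x₂} Φ≡0 refl t≢0) fx₁≡x₂)
    , sym (from (xPar⇔ t≢0) (x₁-identity x₁ x₂))
    , sym (from (xPar⇔ t≢0) (x₂-identity x₁ x₂))
  where
  t = x₁ + x₂
  Φ≡0 : Φ x₁ x₂ ≡ 0ℚ
  Φ≡0 = two-cycle⇒Φ≡0 {c} fx₁≡x₂ (subst (λ x → f4 c x ≡ x₁) fx₁≡x₂ f²x₁≡x₁)
                      (λ x₁≡x₂ → fx₁≢x₁ (trans fx₁≡x₂ (sym x₁≡x₂)))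
  t≢0 : t ≢ 0ℚ
  t≢0 = Φ≡0⇒+≢0 {x₁} {x₂} Φ≡0
  x₁-identity : ∀ x₁ x₂ → let t = x₁ + x₂ in t * t + t * (x₁ - x₂) ≡ t * (2ℚ * x₁)
  x₁-identity x₁ x₂ = solve (x₁ ∷ x₂ ∷ []) ℚ-ring
  x₂-identity : ∀ x₁ x₂ → let t = x₁ + x₂ in t * t + - (t * (x₁ - x₂)) ≡ t * (2ℚ * x₂)
  x₂-identity x₁ x₂ = solve (x₁ ∷ x₂ ∷ []) ℚ-ring

parametrised⇒twoCycle : ∀ {c x₁ x₂} → Parametrised c x₁ x₂ → TwoCycle c x₁ x₂
parametrised⇒twoCycle (t , y , t≢0 , quartic , refl , refl , refl) =
  (trans (cong (f4 c) fx₁≡x₂) fx₂≡x₁ , fx₁≢x₁) , fx₁≡x₂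
  where
  c = cPar t t≢0
  x₁ = xPar t t≢0 y
  x₂ = xPar t t≢0 (- y)
  x₁+x₂≡t : x₁ + x₂ ≡ t
  x₁+x₂≡t = xPar-+ t≢0 y
  Φ≡0 : Φ x₁ x₂ ≡ 0ℚ
  Φ≡0 = from (Φ≡0⇔quartic {x₁} {x₂} x₁+x₂≡t (xPar-- t≢0 y) t≢0) quartic
  fx₁≡x₂ : f4 c x₁ ≡ x₂
  fx₁≡x₂ = from (f4≡⇔cPar≡ {c} {x₁} {x₂} Φ≡0 x₁+x₂≡t t≢0) refl
  fx₂≡x₁ : f4 c x₂ ≡ x₁
  fx₂≡x₁ = from (f4≡⇔cPar≡ {c} {x₂} {x₁} (trans (Φ-comm x₂ x₁) Φ≡0) (trans (+-comm x₂ x₁) x₁+x₂≡t) t≢0) refl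
  fx₁≢x₁ : f4 c x₁ ≢ x₁
  fx₁≢x₁ fx₁≡x₁ = quartic≢0 t≢0 (trans (sym quartic) (cong (λ z → z * z) y≡0))
    where
    y≡0 : y ≡ 0ℚ
    y≡0 = begin
      y               ≡⟨ xPar-- t≢0 y ⟨
      t * (x₁ - x₂)   ≡⟨ cong (t *_) (≡⇒-≡0 (trans (sym fx₁≡x₁) fx₁≡x₂)) ⟩
      t * 0ℚ          ≡⟨ *-zeroʳ t ⟩
      0ℚ              ∎

-- Doubling on the Mordell curve Y² = X³ - 4

Odd : ℤ → Set
Odd z = ¬ 2 ℤ∣.∣ z

odd-* : ∀ {m n} → Odd m → Odd n → Odd (m ℤ.* n)
odd-* {m} {n} m-odd n-odd 2∣mn =
  [ m-odd ∘ ℤ∣.∣ᵤ⇒∣ , n-odd ∘ ℤ∣.∣ᵤ⇒∣ ]′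
    (euclidsLemma ℤ.∣ m ∣ ℤ.∣ n ∣ prime[2] (subst (2 ∣_) (ℤ.abs-* m n) (ℤ∣.∣⇒∣ᵤ 2∣mn)))

odd-+-even : ∀ {m} k → Odd m → Odd (m ℤ.+ 2 ℤ.* k)
odd-+-even k m-odd 2∣m+2k = m-odd (ℤ∣.∣m+n∣n⇒∣m 2∣m+2k (ℤ∣.∣m⇒∣m*n k ℤ∣.∣-refl))

odd⇒≢0 : ∀ {z} → Odd z → z ≢ 0
odd⇒≢0 z-odd refl = z-odd (ℤ∣.∣ᵤ⇒∣ (2 ∣0))

-- (A : B : D) stands for the point (A / D², B / D³).
record WPoint : Set where
  constructor point
  field
    A B D : ℤ

cubic : ℤ → ℤ → ℤ
cubic A D = A ℤ.* A ℤ.* A ℤ.- 4 ℤ.* (D ℤ.* D ℤ.* D ℤ.* (D ℤ.* D ℤ.* D))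

OnCurve : WPoint → Set
OnCurve (point A B D) = B ℤ.* B ≡ cubic A D

-- Tangent-line doubling X ↦ (9 X⁴ - 8 X Y²) / (4 Y²), written in the coordinates (A : B : D).
double : WPoint → WPoint
double (point A B D) = point
  (9 ℤ.* (A ℤ.* A ℤ.* A ℤ.* A) ℤ.- 8 ℤ.* A ℤ.* (B ℤ.* B))
  (36 ℤ.* (A ℤ.* A ℤ.* A) ℤ.* (B ℤ.* B) ℤ.- 27 ℤ.* (A ℤ.* A ℤ.* A ℤ.* (A ℤ.* A ℤ.* A))
    ℤ.- 8 ℤ.* (B ℤ.* B ℤ.* B ℤ.* B))
  (B ℤ.* (2 ℤ.* D))

double-onCurve : ∀ P → OnCurve P → OnCurve (double P)
double-onCurve (point A B D) on = ℤ.i-j≡0⇒i≡j _ _ (begin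
  B′ ℤ.* B′ ℤ.- cubic A′ D′                  ≡⟨ identity A B D ⟩
  64 ℤ.* B⁶ ℤ.* (B ℤ.* B ℤ.- cubic A D)      ≡⟨ cong (64 ℤ.* B⁶ ℤ.*_) (ℤ.i≡j⇒i-j≡0 on) ⟩
  64 ℤ.* B⁶ ℤ.* 0                            ≡⟨ ℤ.*-zeroʳ (64 ℤ.* B⁶) ⟩
  0                                          ∎)
  where
  open WPoint (double (point A B D)) renaming (A to A′; B to B′; D to D′)
  B⁶ = B ℤ.* B ℤ.* B ℤ.* (B ℤ.* B ℤ.* B)
  identity : ∀ A B D →
    let A′ = 9 ℤ.* (A ℤ.* A ℤ.* A ℤ.* A) ℤ.- 8 ℤ.* A ℤ.* (B ℤ.* B)
        B′ = 36 ℤ.* (A ℤ.* A ℤ.* A) ℤ.* (B ℤ.* B) ℤ.- 27 ℤ.* (A ℤ.* A ℤ.* A ℤ.* (A ℤ.* A ℤ.* A))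
               ℤ.- 8 ℤ.* (B ℤ.* B ℤ.* B ℤ.* B)
        D′ = B ℤ.* (2 ℤ.* D)
    in B′ ℤ.* B′ ℤ.- (A′ ℤ.* A′ ℤ.* A′ ℤ.- 4 ℤ.* (D′ ℤ.* D′ ℤ.* D′ ℤ.* (D′ ℤ.* D′ ℤ.* D′)))
       ≡ 64 ℤ.* (B ℤ.* B ℤ.* B ℤ.* (B ℤ.* B ℤ.* B))
            ℤ.* (B ℤ.* B ℤ.- (A ℤ.* A ℤ.* A ℤ.- 4 ℤ.* (D ℤ.* D ℤ.* D ℤ.* (D ℤ.* D ℤ.* D))))
  identity A B D = solve (A ∷ B ∷ D ∷ []) ℤ-ring

-- P is 2-adically within 2⁻ⁿ of the point at infinity.
record Deep (n : ℕ) (P : WPoint) : Set where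
  open WPoint P
  field
    onCurve : OnCurve P
    A-odd   : Odd A
    B-odd   : Odd B
    D≢0     : D ≢ 0
    2ⁿ∣D    : 2 ℕ.^ n ∣ ℤ.∣ D ∣

double-deep : ∀ {n} P → Deep n P → Deep (suc n) (double P)
double-deep {n} P@(point A B D) deep = record
  { onCurve = double-onCurve P onCurve
  ; A-odd   = subst Odd (sym (A′-parity A B)) (odd-+-even _ (odd-* A²-odd A²-odd))
  ; B-odd   = subst Odd (sym (B′-parity A B)) (odd-+-even _ (odd-* A³-odd A³-odd))
  ; D≢0     = [ odd⇒≢0 B-odd , [ (λ ()) , D≢0 ]′ ∘ ℤ.i*j≡0⇒i≡0∨j≡0 2 ]′ ∘ ℤ.i*j≡0⇒i≡0∨j≡0 B
  ; 2ⁿ∣D    = subst (2 ℕ.^ suc n ∣_) (sym ∣D′∣) (∣n⇒∣m*n ℤ.∣ B ∣ (*-monoʳ-∣ 2 2ⁿ∣D))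
  }
  where
  open Deep deep
  A²-odd : Odd (A ℤ.* A)
  A²-odd = odd-* A-odd A-odd
  A³-odd : Odd (A ℤ.* A ℤ.* A)
  A³-odd = odd-* A²-odd A-odd
  ∣D′∣ : ℤ.∣ B ℤ.* (2 ℤ.* D) ∣ ≡ ℤ.∣ B ∣ ℕ.* (2 ℕ.* ℤ.∣ D ∣)
  ∣D′∣ = trans (ℤ.abs-* B (2 ℤ.* D)) (cong (ℤ.∣ B ∣ ℕ.*_) (ℤ.abs-* 2 D))
  A′-parity : ∀ A B → 9 ℤ.* (A ℤ.* A ℤ.* A ℤ.* A) ℤ.- 8 ℤ.* A ℤ.* (B ℤ.* B)
    ≡ A ℤ.* A ℤ.* (A ℤ.* A) ℤ.+ 2 ℤ.* (4 ℤ.* (A ℤ.* A ℤ.* A ℤ.* A) ℤ.- 4 ℤ.* A ℤ.* (B ℤ.* B))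
  A′-parity = ℤ-solve-∀
  B′-parity : ∀ A B → 36 ℤ.* (A ℤ.* A ℤ.* A) ℤ.* (B ℤ.* B) ℤ.- 27 ℤ.* (A ℤ.* A ℤ.* A ℤ.* (A ℤ.* A ℤ.* A))
                      ℤ.- 8 ℤ.* (B ℤ.* B ℤ.* B ℤ.* B)
    ≡ A ℤ.* A ℤ.* A ℤ.* (A ℤ.* A ℤ.* A)
      ℤ.+ 2 ℤ.* (18 ℤ.* (A ℤ.* A ℤ.* A) ℤ.* (B ℤ.* B) ℤ.- 14 ℤ.* (A ℤ.* A ℤ.* A ℤ.* (A ℤ.* A ℤ.* A))
                 ℤ.- 4 ℤ.* (B ℤ.* B ℤ.* B ℤ.* B))
  B′-parity = ℤ-solve-∀

points : ℕ → WPoint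
points zero    = point 5 11 1
points (suc n) = double (points n)

points-deep : ∀ n → Deep n (points n)
points-deep zero = record
  { onCurve = refl ; A-odd = from-no (2 ℤ∣.∣? 5) ; B-odd = from-no (2 ℤ∣.∣? 11) ; D≢0 = λ () ; 2ⁿ∣D = 1∣ 1 }
points-deep (suc n) = double-deep (points n) (points-deep n)

-- From the Mordell curve to the quartic: a t = -2 d², a² y = 2 b d

mordell⇒t≢0 : ∀ {a d t} → d ≢ 0ℚ → a * t ≡ - (2ℚ * (d * d)) → t ≢ 0ℚ
mordell⇒t≢0 {a} d≢0 at≡ refl =
  d≢0 (*≡0⇒≡0 d≢0 (*≡0⇒≡0 2≢0 (neg-injective (trans (sym at≡) (*-zeroʳ a)))))

mordell⇒quartic : ∀ {a b d t y} → a ≢ 0ℚ →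
  a * t ≡ - (2ℚ * (d * d)) → a * (a * y) ≡ 2ℚ * b * d →
  b * b ≡ a * a * a - 4ℚ * (d * d * d * (d * d * d)) →
  y * y ≡ - (t * t * t * t) - 2ℚ * t
mordell⇒quartic {a} {b} {d} {t} {y} a≢0 at≡ aay≡ curve = cancel (cancel (cancel (cancel (begin
  a * (a * (a * (a * (y * y))))                                 ≡⟨ solve (a ∷ y ∷ []) ℚ-ring ⟩
  a * (a * y) * (a * (a * y))                                   ≡⟨ cong (λ z → z * z) aay≡ ⟩
  2ℚ * b * d * (2ℚ * b * d)                                     ≡⟨ solve (b ∷ d ∷ []) ℚ-ring ⟩
  4ℚ * (d * d) * (b * b)                                        ≡⟨ cong (4ℚ * (d * d) *_) curve ⟩
  4ℚ * (d * d) * (a * a * a - 4ℚ * (d * d * d * (d * d * d)))   ≡⟨ solve (a ∷ d ∷ []) ℚ-ring ⟩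
  - (- (2ℚ * (d * d)) * - (2ℚ * (d * d)) * - (2ℚ * (d * d)) * - (2ℚ * (d * d)))
    - 2ℚ * (a * a * a) * - (2ℚ * (d * d))
      ≡⟨ cong (λ s → - (s * s * s * s) - 2ℚ * (a * a * a) * s) at≡ ⟨
  - (a * t * (a * t) * (a * t) * (a * t)) - 2ℚ * (a * a * a) * (a * t)
      ≡⟨ solve (a ∷ t ∷ []) ℚ-ring ⟩
  a * (a * (a * (a * (- (t * t * t * t) - 2ℚ * t))))           ∎))))
  where
  cancel : ∀ {p q} → a * p ≡ a * q → p ≡ q
  cancel = *-cancelˡ-≡ a≢0

mordell⇒c : ∀ {a d t c} → a * t ≡ - (2ℚ * (d * d)) →
  t * t * t * t * t * t + 4ℚ * (t * t * t) - 1ℚ ≡ t * (t * (4ℚ * c)) →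
  let a³ = a * a * a; d⁶ = d * d * d * (d * d * d) in
  c * (16 * (a * a * a * a) * (d * d * d * d)) ≡ 64 * (d⁶ * d⁶) - 32 * d⁶ * a³ - a³ * a³
mordell⇒c {a} {d} {t} {c} at≡ P≡ = begin
  c * (16 * (a * a * a * a) * (d * d * d * d))
    ≡⟨ solve (a ∷ d ∷ c ∷ []) ℚ-ring ⟩
  a * a * a * a * (4ℚ * c) * (- (2ℚ * (d * d)) * - (2ℚ * (d * d)))
    ≡⟨ cong (λ s → a * a * a * a * (4ℚ * c) * (s * s)) at≡ ⟨
  a * a * a * a * (4ℚ * c) * (a * t * (a * t))
    ≡⟨ solve (a ∷ t ∷ c ∷ []) ℚ-ring ⟩
  a * a * a * (a * a * a) * (t * (t * (4ℚ * c)))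
    ≡⟨ cong (a * a * a * (a * a * a) *_) P≡ ⟨
  a * a * a * (a * a * a) * (t * t * t * t * t * t + 4ℚ * (t * t * t) - 1ℚ)
    ≡⟨ solve (a ∷ t ∷ []) ℚ-ring ⟩
  a * t * (a * t) * (a * t) * (a * t) * (a * t) * (a * t) + 4ℚ * (a * t * (a * t) * (a * t)) * (a * a * a)
    - a * a * a * (a * a * a)
    ≡⟨ cong (λ s → s * s * s * s * s * s + 4ℚ * (s * s * s) * (a * a * a) - a * a * a * (a * a * a)) at≡ ⟩
  - (2ℚ * (d * d)) * - (2ℚ * (d * d)) * - (2ℚ * (d * d)) * - (2ℚ * (d * d)) * - (2ℚ * (d * d))
    * - (2ℚ * (d * d))
    + 4ℚ * (- (2ℚ * (d * d)) * - (2ℚ * (d * d)) * - (2ℚ * (d * d))) * (a * a * a) - a * a * a * (a * a * a)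
    ≡⟨ solve (a ∷ d ∷ []) ℚ-ring ⟩
  64 * (d * d * d * (d * d * d) * (d * d * d * (d * d * d)))
    - 32 * (d * d * d * (d * d * d)) * (a * a * a) - a * a * a * (a * a * a) ∎

-- The value of c at (A : B : D) is cNum A D / cDen A D.
cNum cDen : ℤ → ℤ → ℤ
cNum A D = let A³ = A ℤ.* A ℤ.* A; D⁶ = D ℤ.* D ℤ.* D ℤ.* (D ℤ.* D ℤ.* D) in
  64 ℤ.* (D⁶ ℤ.* D⁶) ℤ.- 32 ℤ.* D⁶ ℤ.* A³ ℤ.- A³ ℤ.* A³
cDen A D = 16 ℤ.* (A ℤ.* A ℤ.* A ℤ.* A) ℤ.* (D ℤ.* D ℤ.* D ℤ.* D)

cNum-parity : ∀ A D → let A³ = A ℤ.* A ℤ.* A; D⁶ = D ℤ.* D ℤ.* D ℤ.* (D ℤ.* D ℤ.* D) in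
  64 ℤ.* (D⁶ ℤ.* D⁶) ℤ.- 32 ℤ.* D⁶ ℤ.* A³ ℤ.- A³ ℤ.* A³
    ≡ A³ ℤ.* A³ ℤ.+ 2 ℤ.* (32 ℤ.* (D⁶ ℤ.* D⁶) ℤ.- 16 ℤ.* D⁶ ℤ.* A³ ℤ.- A³ ℤ.* A³)
cNum-parity A D = solve (A ∷ D ∷ []) ℤ-ring

fromℤ-sixth : ∀ z → fromℤ (z ℤ.* z ℤ.* z ℤ.* (z ℤ.* z ℤ.* z))
                    ≡ fromℤ z * fromℤ z * fromℤ z * (fromℤ z * fromℤ z * fromℤ z)
fromℤ-sixth z = trans (fromℤ-* (z ℤ.* z ℤ.* z) (z ℤ.* z ℤ.* z)) (cong₂ _*_ (fromℤ-cube z) (fromℤ-cube z))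

fromℤ-cubic : ∀ A D → let a = fromℤ A; d = fromℤ D in
  fromℤ (cubic A D) ≡ a * a * a - 4ℚ * (d * d * d * (d * d * d))
fromℤ-cubic A D = trans (fromℤ-- (A ℤ.* A ℤ.* A) (4 ℤ.* D⁶))
  (cong₂ _-_ (fromℤ-cube A) (trans (fromℤ-* 4 D⁶) (cong (4ℚ *_) (fromℤ-sixth D))))
  where D⁶ = D ℤ.* D ℤ.* D ℤ.* (D ℤ.* D ℤ.* D)

fromℤ-cNum : ∀ A D → let a = fromℤ A; d = fromℤ D; a³ = a * a * a; d⁶ = d * d * d * (d * d * d) in
  fromℤ (cNum A D) ≡ 64 * (d⁶ * d⁶) - 32 * d⁶ * a³ - a³ * a³
fromℤ-cNum A D = begin
  fromℤ (64 ℤ.* (D⁶ ℤ.* D⁶) ℤ.- 32 ℤ.* D⁶ ℤ.* A³ ℤ.- A³ ℤ.* A³)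
    ≡⟨ fromℤ-- (64 ℤ.* (D⁶ ℤ.* D⁶) ℤ.- 32 ℤ.* D⁶ ℤ.* A³) (A³ ℤ.* A³) ⟩
  fromℤ (64 ℤ.* (D⁶ ℤ.* D⁶) ℤ.- 32 ℤ.* D⁶ ℤ.* A³) - fromℤ (A³ ℤ.* A³)
    ≡⟨ cong₂ _-_ (fromℤ-- (64 ℤ.* (D⁶ ℤ.* D⁶)) (32 ℤ.* D⁶ ℤ.* A³)) (fromℤ-* A³ A³) ⟩
  fromℤ (64 ℤ.* (D⁶ ℤ.* D⁶)) - fromℤ (32 ℤ.* D⁶ ℤ.* A³) - fromℤ A³ * fromℤ A³
    ≡⟨ cong₂ (λ u v → u - v - fromℤ A³ * fromℤ A³)
             (trans (fromℤ-* 64 (D⁶ ℤ.* D⁶)) (cong (64 *_) (fromℤ-* D⁶ D⁶)))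
             (trans (fromℤ-* (32 ℤ.* D⁶) A³) (cong (_* fromℤ A³) (fromℤ-* 32 D⁶))) ⟩
  64 * (fromℤ D⁶ * fromℤ D⁶) - 32 * fromℤ D⁶ * fromℤ A³ - fromℤ A³ * fromℤ A³
    ≡⟨ cong₂ (λ x³ y⁶ → 64 * (y⁶ * y⁶) - 32 * y⁶ * x³ - x³ * x³) (fromℤ-cube A) (fromℤ-sixth D) ⟩
  64 * (d⁶ * d⁶) - 32 * d⁶ * a³ - a³ * a³ ∎
  where
  A³ = A ℤ.* A ℤ.* A
  D⁶ = D ℤ.* D ℤ.* D ℤ.* (D ℤ.* D ℤ.* D)
  a³ = fromℤ A * fromℤ A * fromℤ A
  d⁶ = fromℤ D * fromℤ D * fromℤ D * (fromℤ D * fromℤ D * fromℤ D)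

fromℤ-cDen : ∀ A D → let a = fromℤ A; d = fromℤ D in
  fromℤ (cDen A D) ≡ 16 * (a * a * a * a) * (d * d * d * d)
fromℤ-cDen A D = trans (fromℤ-* (16 ℤ.* (A ℤ.* A ℤ.* A ℤ.* A)) (D ℤ.* D ℤ.* D ℤ.* D))
  (cong₂ _*_ (trans (fromℤ-* 16 (A ℤ.* A ℤ.* A ℤ.* A)) (cong (16 *_) (fromℤ-fourth A))) (fromℤ-fourth D))
  where
  fromℤ-fourth : ∀ z → fromℤ (z ℤ.* z ℤ.* z ℤ.* z) ≡ fromℤ z * fromℤ z * fromℤ z * fromℤ z
  fromℤ-fourth z = trans (fromℤ-* (z ℤ.* z ℤ.* z) z) (cong (_* fromℤ z) (fromℤ-cube z))

-- Denominators

prime^k∣m*n⇒prime^k∣n : ∀ {p m n} k → Prime p → ¬ p ∣ m → p ℕ.^ k ∣ m ℕ.* n → p ℕ.^ k ∣ n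
prime^k∣m*n⇒prime^k∣n {n = n} zero _ _ _ = 1∣ n
prime^k∣m*n⇒prime^k∣n {p} {m} {n} (suc k) p-prime p∤m p^k+1∣mn
  with euclidsLemma m n p-prime (∣-trans (m∣m*n (p ℕ.^ k)) p^k+1∣mn)
... | inj₁ p∣m = ⊥-elim (p∤m p∣m)
... | inj₂ (divides n′ refl) = subst (p ℕ.^ suc k ∣_) (ℕ.*-comm p n′) (*-monoʳ-∣ p p^k∣n′)
  where
  instance _ = prime⇒nonZero p-prime
  rearrange : ∀ m n′ p → m ℕ.* (n′ ℕ.* p) ≡ p ℕ.* (m ℕ.* n′)
  rearrange = ℕ-solve-∀
  p^k∣n′ : p ℕ.^ k ∣ n′
  p^k∣n′ = prime^k∣m*n⇒prime^k∣n k p-prime p∤m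
             (*-cancelˡ-∣ p (subst (p ℕ.^ suc k ∣_) (rearrange m n′ p) p^k+1∣mn))

*fromℤ≡fromℤ⇒prime^k∣↧ : ∀ {p q m n} k → Prime p → q * fromℤ m ≡ fromℤ n →
                         ¬ p ∣ ℤ.∣ n ∣ → p ℕ.^ k ∣ ℤ.∣ m ∣ → p ℕ.^ k ∣ ↧ₙ q
*fromℤ≡fromℤ⇒prime^k∣↧ {p} {q@(mkℚ _ _ _)} {m} {n} k p-prime eq p∤n p^k∣m =
  prime^k∣m*n⇒prime^k∣n k p-prime p∤n (subst (p ℕ.^ k ∣_) cross (∣n⇒∣m*n ℤ.∣ ↥ q ∣ p^k∣m))
  where
  cross : ℤ.∣ ↥ q ∣ ℕ.* ℤ.∣ m ∣ ≡ ℤ.∣ n ∣ ℕ.* ↧ₙ q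
  cross = trans (sym (ℤ.abs-* (↥ q) m)) (trans (cong ℤ.∣_∣ (to (*fromℤ≡fromℤ⇔ q m n) eq)) (ℤ.abs-* n (↧ q)))

deep⇒c : ∀ {n} P → Deep n P → ∃[ c ] ((2 ℕ.^ n ∣ ↧ₙ c) × ∃[ x ] IsPeriod2 (f4 c) x)
deep⇒c {n} (point A B D) deep =
  c , *fromℤ≡fromℤ⇒prime^k∣↧ {q = c} {cDen A D} {cNum A D} n prime[2] c·cDen≡cNum
                                (cNum-odd ∘ ℤ∣.∣ᵤ⇒∣) 2ⁿ∣cDen
    , xPar t t≢0 y , proj₁ (parametrised⇒twoCycle (t , y , t≢0 , quartic , refl , refl , refl))
  where
  open Deep deep
  a = fromℤ A
  b = fromℤ B
  d = fromℤ D
  a≢0 : a ≢ 0ℚ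
  a≢0 = fromℤ-≢0 (odd⇒≢0 A-odd)
  t = (- (2ℚ * (d * d))) ÷[ a ] a≢0
  y = ((2ℚ * b * d) ÷[ a ] a≢0) ÷[ a ] a≢0
  t≢0 : t ≢ 0ℚ
  t≢0 = mordell⇒t≢0 {a} {d} {t} (fromℤ-≢0 D≢0) (*-÷ a≢0)
  quartic : y * y ≡ - (t * t * t * t) - 2ℚ * t
  quartic = mordell⇒quartic {a} {b} {d} {t} {y} a≢0 (*-÷ a≢0)
              (trans (cong (a *_) (*-÷ {p = (2ℚ * b * d) ÷[ a ] a≢0} a≢0)) (*-÷ a≢0))
              (trans (sym (fromℤ-* B B)) (trans (cong fromℤ onCurve) (fromℤ-cubic A D)))
  c = cPar t t≢0
  c·cDen≡cNum : c * fromℤ (cDen A D) ≡ fromℤ (cNum A D)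
  c·cDen≡cNum = trans (cong (c *_) (fromℤ-cDen A D))
                  (trans (mordell⇒c {a} {d} {t} {c} (*-÷ a≢0) (to (cPar⇔ t≢0) refl)) (sym (fromℤ-cNum A D)))
  cNum-odd : Odd (cNum A D)
  cNum-odd = subst Odd (sym (cNum-parity A D)) (odd-+-even _ (odd-* A³-odd A³-odd))
    where
    A³-odd : Odd (A ℤ.* A ℤ.* A)
    A³-odd = odd-* (odd-* A-odd A-odd) A-odd
  2ⁿ∣cDen : 2 ℕ.^ n ∣ ℤ.∣ cDen A D ∣
  2ⁿ∣cDen = ∣-trans 2ⁿ∣D (ℤ∣.∣⇒∣ᵤ
    (ℤ∣.∣n⇒∣m*n (16 ℤ.* (A ℤ.* A ℤ.* A ℤ.* A)) (ℤ∣.∣n⇒∣m*n (D ℤ.* D ℤ.* D) (ℤ∣.∣-refl {D}))))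

n<2^n : ∀ n → n ℕ.< 2 ℕ.^ n
n<2^n zero    = ℕ.z<s
n<2^n (suc n) = subst (suc (suc n) ℕ.≤_) (cong (2 ℕ.^ n ℕ.+_) (sym (ℕ.+-identityʳ _)))
                      (ℕ.+-mono-≤ (ℕ.m^n>0 2 n) (n<2^n n))

∈⇒↧≤max : ∀ {c l} → c ∈ l → ↧ₙ c ℕ.≤ max 0 (map ↧ₙ_ l)
∈⇒↧≤max {c} {l} c∈l = All.lookup (xs≤max 0 (map ↧ₙ_ l)) (∈-map⁺ ↧ₙ_ c∈l)

2^max∣↧⇒∉ : ∀ {c} l → 2 ℕ.^ max 0 (map ↧ₙ_ l) ∣ ↧ₙ c → c ∉ l
2^max∣↧⇒∉ l 2ⁿ∣↧c c∈l = ℕ.<-irrefl refl (ℕ.<-≤-trans (n<2^n _) (ℕ.≤-trans (∣⇒≤ 2ⁿ∣↧c) (∈⇒↧≤max c∈l)))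

infinitelyMany : ∀ (l : List ℚ) → ∃[ c ] ((c ∉ l) × (∃[ x ] IsPeriod2 (f4 c) x))
infinitelyMany l = map₂ (map₁ (2^max∣↧⇒∉ l)) (deep⇒c _ (points-deep (max 0 (map ↧ₙ_ l))))

theorem2p1 : (∀ (l : List ℚ) → ∃[ c ] ((c ∉ l) × (∃[ x ] IsPeriod2 (f4 c) x)))
    × (∀ (c x₁ x₂ : ℚ) →
         (IsPeriod2 (f4 c) x₁ × (f4 c x₁ ≡ x₂))
         ⇔ (∃[ t ] ∃[ y ] Σ[ t≢0 ∈ t ≢ 0ℚ ]
              ((y * y ≡ - (t * t * t * t) - 2ℚ * t)
               × (c ≡ cPar t t≢0)
               × (x₁ ≡ xPar t t≢0 y)
               × (x₂ ≡ xPar t t≢0 (- y)))))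
theorem2p1 = infinitelyMany , λ _ _ _ → mk⇔ twoCycle⇒parametrised parametrised⇒twoCycle
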